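{- Let $A$ be an alphabet with $|A| = 2$, let $n$ be a positive integer and $k \ge 2$ an integer. If $w = u\diamond^k v$ is a universal partial word for $A^n$, where $u$ and $v$ are nonempty words over $A$ (containing no $\diamond$), then $|u| \le n-1$ and $|v| \le n-1$.
   Context: A partial word over $A$ is a finite sequence of characters from $A \cup \{\diamond\}$, where $\diamond \notin A$ is a wild-card symbol; a word over $A$ contains no $\diamond$. $A^n$ denotes the set of words of length $n$ over $A$. For $x = x_1\cdots x_n \in A^n$ and a partial word $w = w_1\cdots w_N$, the position $i$ ($0 \le i \le N-n$) covers $x$ if $x_j = w_{i+j}$ for every $1\le j\le n$ with $w_{i+j}\in A$. A universal partial word for $A^n$ is a partial word $w$ such that every word in $A^n$ is covered by exactly one position of $w$. $\diamond^k$ denotes $k$ consecutive $\diamond$'s. -}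

module Defs where

open import Data.Nat using (ℕ; _+_; _≤_)
open import Data.List using (List; []; _∷_; length; take; drop; map)
open import Data.Unit using (⊤)
open import Data.Maybe using (Maybe; just; nothing)
open import Data.Product using (Σ; _×_; ∃-syntax)
open import Relation.Binary.PropositionalEquality using (_≡_)

-- A partial word over A: a list of letters, where 'nothing' is the hole ⋄.
PartialWord : Set → Set
PartialWord A = List (Maybe A)

⋄ : {A : Set} → Maybe A
⋄ = nothing

full : {A : Set} → List A → PartialWord A
full = map just

Compat : {A : Set} → Maybe A → A → Set
Compat (just a) c = a ≡ c
Compat nothing  c = ⊤

data CompatW {A : Set} : PartialWord A → List A → Set where
  []  : CompatW [] []
  _∷_ : ∀ {m c ms cs} → Compat m c → CompatW ms cs → CompatW (m ∷ ms) (c ∷ cs)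

Covers : {A : Set} → PartialWord A → ℕ → List A → Set
Covers w i x = (i + length x ≤ length w) × CompatW (take (length x) (drop i w)) x

UniversalPW : (A : Set) → ℕ → PartialWord A → Set
UniversalPW A n w =
  (x : List A) → length x ≡ n →
  ∃[ i ] (Covers w i x × ((j : ℕ) → Covers w j x → j ≡ i))

-- If the prefix u had length at least n - 1, then w = p d t ⋄ ⋄ ... l with letters d, l,
-- a word t of length n - 2 and l the last letter of w. Let x = d' t l', where primes denote
-- the other letter. Where x is covered, its last letter cannot face l, so the window slides
-- one step right and covers t l' c for some letter c. That word is also covered by t ⋄ ⋄,
-- so by uniqueness x starts just before t, where its first letter d' faces d. Hence
-- |u| ≤ n - 2, and the bound on v follows because reversal preserves universality.
-- For n = 1 the two adjacent holes cover each letter twice.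

module Submission where

open import Defs
open import Data.Nat using (ℕ; _≤_; _∸_; _≥_; NonZero)
open import Data.Fin using (Fin)
open import Data.List using (List; length; replicate; _++_)
open import Data.Product using (_×_)
open import Function.Bundles using (_↔_)
open import Relation.Binary.PropositionalEquality using (_≢_)

open import Function using (Inverse; _∘_)
import Data.Fin as Fin
open import Data.Nat using (zero; suc; _+_; _<_; s≤s; _≤?_)
open import Data.Empty using (⊥-elim)
open import Data.Nat.Properties
open import Data.List using ([]; _∷_; _∷ʳ_; take; drop; reverse; initLast; _∷ʳ′_)
open import Data.List.Properties
open import Data.List.Relation.Binary.Pointwise as Pointwise using (Pointwise; []; _∷_; Pointwise-length)
open import Data.Maybe using (just; nothing; fromMaybe)
open import Data.Product using (_,_; proj₁; proj₂; ∃-syntax)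
open import Data.Unit using (tt)
open import Data.Sum using (inj₁; inj₂)
open import Relation.Binary.PropositionalEquality using (_≡_; refl; sym; trans; cong; cong₂; subst; module ≡-Reasoning)
open import Relation.Nullary using (¬_; yes; no)

module _ {A : Set} where

  compatW⇒pointwise : ∀ {s : PartialWord A} {x} → CompatW s x → Pointwise Compat s x
  compatW⇒pointwise []       = []
  compatW⇒pointwise (c ∷ cs) = c ∷ compatW⇒pointwise cs

  pointwise⇒compatW : ∀ {s : PartialWord A} {x} → Pointwise Compat s x → CompatW s x
  pointwise⇒compatW []       = []
  pointwise⇒compatW (c ∷ cs) = c ∷ pointwise⇒compatW cs

  full-compat : (x : List A) → Pointwise Compat (full x) x
  full-compat []      = []
  full-compat (a ∷ x) = refl ∷ full-compat x

  Compat-fromMaybe : ∀ (a : A) m → Compat m (fromMaybe a m)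
  Compat-fromMaybe a (just b) = refl
  Compat-fromMaybe a nothing  = tt

module _ {B : Set} where

  drop-length-++ : (xs ys : List B) → drop (length xs) (xs ++ ys) ≡ ys
  drop-length-++ []       ys = refl
  drop-length-++ (x ∷ xs) ys = drop-length-++ xs ys

  take-length-++ : (xs ys : List B) → take (length xs) (xs ++ ys) ≡ xs
  take-length-++ []       ys = refl
  take-length-++ (x ∷ xs) ys = cong (x ∷_) (take-length-++ xs ys)

  ∷-aligned : ∀ (xs ys : List B) {a b zs ws} → length xs ≡ length ys →
              xs ++ a ∷ zs ≡ ys ++ b ∷ ws → a ≡ b
  ∷-aligned []       []       _   eq = ∷-injectiveˡ eq
  ∷-aligned (x ∷ xs) (y ∷ ys) len eq = ∷-aligned xs ys (suc-injective len) (∷-injectiveʳ eq)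

  replicate-∷ʳ : ∀ n (b : B) → replicate n b ∷ʳ b ≡ b ∷ replicate n b
  replicate-∷ʳ zero    b = refl
  replicate-∷ʳ (suc n) b = cong (b ∷_) (replicate-∷ʳ n b)

  reverse-replicate : ∀ n (b : B) → reverse (replicate n b) ≡ replicate n b
  reverse-replicate zero    b = refl
  reverse-replicate (suc n) b = begin
    reverse (b ∷ replicate n b)  ≡⟨ reverse-++ (b ∷ []) (replicate n b) ⟩
    reverse (replicate n b) ∷ʳ b ≡⟨ cong (_∷ʳ b) (reverse-replicate n b) ⟩
    replicate n b ∷ʳ b           ≡⟨ replicate-∷ʳ n b ⟩
    b ∷ replicate n b            ∎
    where open ≡-Reasoning

  length-∷ʳ : ∀ (xs : List B) b → length (xs ∷ʳ b) ≡ suc (length xs)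
  length-∷ʳ xs b = trans (length-++ xs) (+-comm (length xs) 1)

  suffix-of-length : ∀ n (xs : List B) → n < length xs →
                     ∃[ ys ] ∃[ z ] ∃[ zs ] xs ≡ ys ++ z ∷ zs × length zs ≡ n
  suffix-of-length n (x ∷ xs) (s≤s n≤|xs|) with m≤n⇒m<n∨m≡n n≤|xs|
  ... | inj₁ n<|xs| = let ys , z , zs , eq , len = suffix-of-length n xs n<|xs|
                      in x ∷ ys , z , zs , cong (x ∷_) eq , len
  ... | inj₂ n≡|xs| = [] , x , xs , refl , sym n≡|xs|

module _ {A : Set} where

  record Window (w : PartialWord A) (i : ℕ) (x : List A) : Set where
    constructor window
    field
      before segment after : PartialWord A
      split                : w ≡ before ++ segment ++ after
      offset               : length before ≡ i
      matches              : Pointwise Compat segment x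

  open Window

  window-length : ∀ {w i x} (o : Window w i x) → i + length x + length (after o) ≡ length w
  window-length {x = x} (window p s q refl refl s≈x) = begin
    length p + length x + length q   ≡⟨ cong (λ m → length p + m + length q) (Pointwise-length s≈x) ⟨
    length p + length s + length q   ≡⟨ +-assoc (length p) (length s) (length q) ⟩
    length p + (length s + length q) ≡⟨ cong (length p +_) (length-++ s) ⟨
    length p + length (s ++ q)       ≡⟨ length-++ p ⟨
    length (p ++ s ++ q)             ∎
    where open ≡-Reasoning

  covers⇒window : ∀ {w i x} → Covers w i x → Window w i x
  covers⇒window {w} {i} {x} (bound , compat) =
    window (take i w) (take (length x) (drop i w)) (drop (length x) (drop i w))
           (sym (trans (cong (take i w ++_) (take++drop≡id (length x) (drop i w))) (take++drop≡id i w)))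
           (trans (length-take i w) (m≤n⇒m⊓n≡m (m+n≤o⇒m≤o i bound)))
           (compatW⇒pointwise compat)

  window⇒covers : ∀ {w i x} → Window w i x → Covers w i x
  window⇒covers {x = x} o@(window p s q refl refl s≈x) =
    subst (_ ≤_) (window-length o) (m≤m+n _ _) ,
    subst (λ s′ → CompatW s′ x) segment-at-offset (pointwise⇒compatW s≈x)
    where
    open ≡-Reasoning
    segment-at-offset : s ≡ take (length x) (drop (length p) (p ++ s ++ q))
    segment-at-offset = begin
      s                                         ≡⟨ take-length-++ s q ⟨
      take (length s) (s ++ q)                  ≡⟨ cong₂ take (Pointwise-length s≈x) (sym (drop-length-++ p (s ++ q))) ⟩
      take (length x) (drop (length p) (p ++ s ++ q)) ∎

  window-letter : ∀ {w i a x} p {d r} → Window w i (a ∷ x) → w ≡ p ++ just d ∷ r → length p ≡ i → d ≡ a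
  window-letter p {d} (window b (m ∷ s) q refl refl (m≈a ∷ _)) w≡ |p|≡|b| =
    subst (λ m′ → Compat m′ _) (∷-aligned b p (sym |p|≡|b|) w≡) m≈a

  reverse-window : ∀ {w i x} (o : Window w i x) → Window (reverse w) (length (after o)) (reverse x)
  reverse-window (window p s q refl refl s≈x) =
    window (reverse q) (reverse s) (reverse p) reversed-split (length-reverse q) (Pointwise.reverse⁺ s≈x)
    where
    open ≡-Reasoning
    reversed-split : reverse (p ++ s ++ q) ≡ reverse q ++ reverse s ++ reverse p
    reversed-split = begin
      reverse (p ++ s ++ q)               ≡⟨ reverse-++ p (s ++ q) ⟩
      reverse (s ++ q) ++ reverse p       ≡⟨ cong (_++ reverse p) (reverse-++ s q) ⟩
      (reverse q ++ reverse s) ++ reverse p ≡⟨ ++-assoc (reverse q) (reverse s) (reverse p) ⟩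
      reverse q ++ reverse s ++ reverse p ∎

  slide-window : ∀ {w i a x m q} (o : Window w i (a ∷ x)) → after o ≡ m ∷ q →
                 ∃[ c ] Window w (suc i) (x ∷ʳ c)
  slide-window {a = a} (window p (m₀ ∷ s) (m ∷ q) refl refl (_ ∷ s≈x)) refl =
    fromMaybe a m ,
    window (p ∷ʳ m₀) (s ∷ʳ m) q slid-split (length-∷ʳ p m₀)
           (Pointwise.++⁺ s≈x (Compat-fromMaybe a m ∷ []))
    where
    open ≡-Reasoning
    slid-split : p ++ (m₀ ∷ s) ++ m ∷ q ≡ (p ∷ʳ m₀) ++ (s ∷ʳ m) ++ q
    slid-split = sym (begin
      (p ∷ʳ m₀) ++ (s ∷ʳ m) ++ q ≡⟨ ++-assoc p (m₀ ∷ []) ((s ∷ʳ m) ++ q) ⟩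
      p ++ m₀ ∷ (s ∷ʳ m) ++ q    ≡⟨ cong (λ z → p ++ m₀ ∷ z) (++-assoc s (m ∷ []) q) ⟩
      p ++ m₀ ∷ s ++ m ∷ q       ∎)

  module _ {n : ℕ} {w : PartialWord A} (U : UniversalPW A n w) where

    window-exists : ∀ x → length x ≡ n → ∃[ i ] Window w i x
    window-exists x |x| = let i , covers , _ = U x |x| in i , covers⇒window covers

    window-unique : ∀ {x i j} → length x ≡ n → Window w i x → Window w j x → i ≡ j
    window-unique {x} |x| o o′ =
      let _ , _ , unique = U x |x| in trans (unique _ (window⇒covers o)) (sym (unique _ (window⇒covers o′)))

  mirror-offset : ∀ i m j a → j + m + i ≡ i + m + a → j ≡ a
  mirror-offset i m j a eq = +-cancelʳ-≡ (m + i) j a (begin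
    j + (m + i) ≡⟨ +-assoc j m i ⟨
    j + m + i   ≡⟨ eq ⟩
    i + m + a   ≡⟨ +-comm (i + m) a ⟩
    a + (i + m) ≡⟨ cong (a +_) (+-comm i m) ⟩
    a + (m + i) ∎)
    where open ≡-Reasoning

  reverse-universal : ∀ {n w} → UniversalPW A n w → UniversalPW A n (reverse w)
  reverse-universal {w = w} U x refl =
    length (after o) , window⇒covers (subst (Window _ _) (reverse-involutive x) (reverse-window o)) , unique
    where
    |x|ʳ = length-reverse x
    i = proj₁ (window-exists U (reverse x) |x|ʳ)
    o = proj₂ (window-exists U (reverse x) |x|ʳ)

    unique : ∀ j → Covers (reverse w) j x → j ≡ length (after o)
    unique j covers = mirror-offset i (length x) j (length (after o)) (begin
      j + length x + i                   ≡⟨ cong (j + length x +_) (window-unique U |x|ʳ o o′ʳ) ⟩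
      j + length x + length (after o′)   ≡⟨ window-length o′ ⟩
      length (reverse w)                 ≡⟨ length-reverse w ⟩
      length w                           ≡⟨ window-length o ⟨
      i + length (reverse x) + length (after o) ≡⟨ cong (λ m → i + m + length (after o)) |x|ʳ ⟩
      i + length x + length (after o)    ∎)
      where
      open ≡-Reasoning
      o′ = covers⇒window covers
      o′ʳ : Window w (length (after o′)) (reverse x)
      o′ʳ = subst (λ v → Window v (length (after o′)) (reverse x)) (reverse-involutive w) (reverse-window o′)

  hole-run-not-universal : ∀ {n} → A → ∀ p r → ¬ UniversalPW A n (p ++ replicate (suc n) ⋄ ++ r)
  hole-run-not-universal {n} a p r U = 1+n≢n (sym (window-unique U (length-replicate n) at-start at-next))
    where
    ⋄≈a : Pointwise Compat (replicate n ⋄) (replicate n a)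
    ⋄≈a = Pointwise.replicate⁺ tt n
    at-start : Window (p ++ replicate (suc n) ⋄ ++ r) (length p) (replicate n a)
    at-start = window p (replicate n ⋄) (⋄ ∷ r) (cong (p ++_) (begin
      ⋄ ∷ replicate n ⋄ ++ r         ≡⟨ cong (_++ r) (replicate-∷ʳ n ⋄) ⟨
      (replicate n ⋄ ∷ʳ ⋄) ++ r      ≡⟨ ++-assoc (replicate n ⋄) (⋄ ∷ []) r ⟩
      replicate n ⋄ ++ ⋄ ∷ r         ∎)) refl ⋄≈a
      where open ≡-Reasoning
    at-next : Window (p ++ replicate (suc n) ⋄ ++ r) (suc (length p)) (replicate n a)
    at-next = window (p ∷ʳ ⋄) (replicate n ⋄) r (sym (++-assoc p (⋄ ∷ []) _)) (length-∷ʳ p ⋄) ⋄≈a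

  reverse-full-⋄-full : ∀ (u : List A) k v →
    reverse (full u ++ replicate k ⋄ ++ full v) ≡ full (reverse v) ++ replicate k ⋄ ++ full (reverse u)
  reverse-full-⋄-full u k v = begin
    reverse (full u ++ replicate k ⋄ ++ full v)                    ≡⟨ reverse-++ (full u) _ ⟩
    reverse (replicate k ⋄ ++ full v) ++ reverse (full u)          ≡⟨ cong (_++ _) (reverse-++ (replicate k ⋄) (full v)) ⟩
    (reverse (full v) ++ reverse (replicate k ⋄)) ++ reverse (full u) ≡⟨ ++-assoc (reverse (full v)) _ _ ⟩
    reverse (full v) ++ reverse (replicate k ⋄) ++ reverse (full u)  ≡⟨ cong₂ _++_ (reverse-map just v)
                                                                          (cong₂ _++_ (sym (reverse-replicate k ⋄)) (reverse-map just u)) ⟨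
    full (reverse v) ++ replicate k ⋄ ++ full (reverse u)          ∎
    where open ≡-Reasoning

module _ {A : Set} (other : A → A) (other-≢ : ∀ a → other a ≢ a) where

  letter-word-⋄⋄-not-universal : ∀ {w : PartialWord A} p r w′ d l (t : List A) →
    w ≡ p ++ just d ∷ full t ++ ⋄ ∷ ⋄ ∷ r → w ≡ w′ ∷ʳ just l →
    ¬ UniversalPW A (2 + length t) w
  letter-word-⋄⋄-not-universal {w} p r w′ d l t w≡pdt w≡w′l U
    with window-exists U (other d ∷ t ∷ʳ other l) (cong suc (length-∷ʳ t (other l)))
  ... | i , o with Window.after o in after≡
  ... | [] = other-≢ l (sym (window-letter [] o-reversed reverse-w (sym (cong length after≡))))
    where
    o-reversed : Window (reverse w) (length (Window.after o)) (other l ∷ reverse (other d ∷ t))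
    o-reversed = subst (Window _ _) (reverse-++ (other d ∷ t) (other l ∷ [])) (reverse-window o)
    reverse-w : reverse w ≡ [] ++ just l ∷ reverse w′
    reverse-w = trans (cong reverse w≡w′l) (reverse-++ w′ (just l ∷ []))
  ... | m ∷ q = other-≢ d (sym (window-letter p o w≡pdt (suc-injective (sym slid≡over-t⋄⋄))))
    where
    open ≡-Reasoning
    c : A
    c = proj₁ (slide-window o after≡)
    y : List A
    y = t ∷ʳ other l ∷ʳ c
    over-t⋄⋄ : Window w (suc (length p)) y
    over-t⋄⋄ = window (p ∷ʳ just d) (full t ++ ⋄ ∷ ⋄ ∷ []) r
      (trans w≡pdt (sym (begin
        (p ∷ʳ just d) ++ (full t ++ ⋄ ∷ ⋄ ∷ []) ++ r ≡⟨ ++-assoc p (just d ∷ []) _ ⟩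
        p ++ just d ∷ (full t ++ ⋄ ∷ ⋄ ∷ []) ++ r   ≡⟨ cong (λ z → p ++ just d ∷ z) (++-assoc (full t) (⋄ ∷ ⋄ ∷ []) r) ⟩
        p ++ just d ∷ full t ++ ⋄ ∷ ⋄ ∷ r           ∎)))
      (length-∷ʳ p (just d))
      (subst (Pointwise Compat _) (sym (++-assoc t (other l ∷ []) (c ∷ [])))
        (Pointwise.++⁺ (full-compat t) (tt ∷ tt ∷ [])))
    slid≡over-t⋄⋄ : suc i ≡ suc (length p)
    slid≡over-t⋄⋄ = window-unique U (trans (length-∷ʳ (t ∷ʳ other l) c) (cong suc (length-∷ʳ t (other l))))
      (proj₂ (slide-window o after≡)) over-t⋄⋄

  prefix-bound : ∀ {n k} (u v : List A) → 2 ≤ k → length v ≢ 0 →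
                 UniversalPW A (2 + n) (full u ++ replicate k ⋄ ++ full v) → length u ≤ n
  prefix-bound {n} {suc (suc k)} u v (s≤s (s≤s _)) |v|≢0 U with length u ≤? n
  ... | yes |u|≤n = |u|≤n
  ... | no |u|≰n with suffix-of-length n u (≰⇒> |u|≰n) | initLast v
  ... | _ | [] = ⊥-elim (|v|≢0 refl)
  ... | u₀ , d , t , refl , refl | v₀ ∷ʳ′ l =
    ⊥-elim (letter-word-⋄⋄-not-universal (full u₀) (replicate k ⋄ ++ full (v₀ ∷ʳ l))
              (full (u₀ ++ d ∷ t) ++ replicate (2 + k) ⋄ ++ full v₀) d l t
              (trans (cong (_++ _) (map-++ just u₀ (d ∷ t))) (++-assoc (full u₀) _ _))
              ends-with-l U)
    where
    open ≡-Reasoning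
    ends-with-l : full (u₀ ++ d ∷ t) ++ replicate (2 + k) ⋄ ++ full (v₀ ∷ʳ l)
                ≡ (full (u₀ ++ d ∷ t) ++ replicate (2 + k) ⋄ ++ full v₀) ∷ʳ just l
    ends-with-l = begin
      full (u₀ ++ d ∷ t) ++ replicate (2 + k) ⋄ ++ full (v₀ ∷ʳ l)
        ≡⟨ cong (λ z → full (u₀ ++ d ∷ t) ++ replicate (2 + k) ⋄ ++ z) (map-++ just v₀ (l ∷ [])) ⟩
      full (u₀ ++ d ∷ t) ++ replicate (2 + k) ⋄ ++ full v₀ ∷ʳ just l
        ≡⟨ cong (full (u₀ ++ d ∷ t) ++_) (++-assoc (replicate (2 + k) ⋄) (full v₀) _) ⟨
      full (u₀ ++ d ∷ t) ++ (replicate (2 + k) ⋄ ++ full v₀) ∷ʳ just l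
        ≡⟨ ++-assoc (full (u₀ ++ d ∷ t)) _ _ ⟨
      (full (u₀ ++ d ∷ t) ++ replicate (2 + k) ⋄ ++ full v₀) ∷ʳ just l ∎

opposite-≢ : (y : Fin 2) → Fin.opposite y ≢ y
opposite-≢ Fin.zero           ()
opposite-≢ (Fin.suc Fin.zero) ()

module _ {A : Set} (A↔Fin2 : A ↔ Fin 2) where
  open Inverse A↔Fin2

  opposite-letter : A → A
  opposite-letter a = from (Fin.opposite (to a))

  opposite-letter-≢ : ∀ a → opposite-letter a ≢ a
  opposite-letter-≢ a eq = opposite-≢ (to a) (trans (sym (strictlyInverseˡ _)) (cong to eq))

theorem3p2 : (A : Set) → A ↔ Fin 2 → (n k : ℕ) → .{{NonZero n}} → k ≥ 2 →
             (u v : List A) → length u ≢ 0 → length v ≢ 0 →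
             UniversalPW A n (full u ++ replicate k ⋄ ++ full v) →
             (length u ≤ n ∸ 1) × (length v ≤ n ∸ 1)
theorem3p2 A A↔Fin2 1 (suc (suc k)) (s≤s (s≤s _)) u v _ _ U =
  ⊥-elim (hole-run-not-universal (Inverse.from A↔Fin2 Fin.zero) (full u) (replicate k ⋄ ++ full v) U)
theorem3p2 A A↔Fin2 (suc (suc n)) k k≥2 u v |u|≢0 |v|≢0 U =
  m≤n⇒m≤1+n (bound u v |v|≢0 U) ,
  m≤n⇒m≤1+n (subst (_≤ n) (length-reverse v)
    (bound (reverse v) (reverse u) (|u|≢0 ∘ trans (sym (length-reverse u)))
      (subst (UniversalPW A _) (reverse-full-⋄-full u k v) (reverse-universal U))))
  where
  bound : ∀ (x y : List A) → length y ≢ 0 → UniversalPW A (2 + n) (full x ++ replicate k ⋄ ++ full y) →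
          length x ≤ n
  bound x y = prefix-bound (opposite-letter A↔Fin2) (opposite-letter-≢ A↔Fin2) x y k≥2
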